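{- For $k \ge 4$, let $T_{II_k}$ be the $k\times k$ binary matrix in which, for $i=1,\dots,k-2$, row $i$ has 1 entries exactly in columns $i$ and $i+1$; row $k-1$ has 1 entries exactly in columns $1,2,\dots,k-2$ and $k$ (and a 0 in column $k-1$); and row $k$ has 1 entries exactly in columns $2,3,\dots,k$ (and a 0 in column $1$). Then the smallest odd cycle in the incompatibility graph of $T_{II_k}$ has length $k$ when $k$ is odd and $k+1$ when $k$ is even.
   Context: For an $m\times n$ binary matrix $M$ with columns $c_1,\dots,c_n$, the incompatibility graph $G_M$ is the undirected graph whose vertices are the ordered pairs $(c_i,c_j)$ with $i\neq j$, and in which two vertices of the form $(c_i,c_j)$ and $(c_j,c_k)$ are adjacent if either $c_i=c_k$, or there is a row $r_l$ of $M$ with $M_{li}=M_{lk}=1$ and $M_{lj}=0$. -}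

module Defs where

open import Data.Nat using (ℕ; zero; suc; _+_; _∸_; _≤_; _<?_)
open import Data.Nat.Properties using (_≟_)
open import Data.Nat.Divisibility using (_∣_)
open import Data.Fin using (Fin; toℕ)
open import Data.Bool using (Bool; true; false; if_then_else_; _∨_; not)
open import Data.Product using (Σ; _×_; _,_; proj₁; proj₂; ∃-syntax)
open import Data.Sum using (_⊎_)
open import Relation.Nullary using (¬_)
open import Relation.Nullary.Decidable using (⌊_⌋)
open import Relation.Binary.PropositionalEquality using (_≡_; _≢_)
open import Function.Definitions using (Injective)

BinMatrix : ℕ → ℕ → Set
BinMatrix m n = Fin m → Fin n → Bool

Vertex : ℕ → Set
Vertex n = Σ (Fin n × Fin n) (λ p → proj₁ p ≢ proj₂ p)

fstC : ∀ {n} → Vertex n → Fin n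
fstC v = proj₁ (proj₁ v)

sndC : ∀ {n} → Vertex n → Fin n
sndC v = proj₂ (proj₁ v)

AdjDir : ∀ {m n} → BinMatrix m n → Vertex n → Vertex n → Set
AdjDir {m} M u v =
  (sndC u ≡ fstC v) ×
  ((fstC u ≡ sndC v) ⊎
   (∃[ l ] ((M l (fstC u) ≡ true) × (M l (sndC v) ≡ true) × (M l (sndC u) ≡ false))))

Adj : ∀ {m n} → BinMatrix m n → Vertex n → Vertex n → Set
Adj M u v = AdjDir M u v ⊎ AdjDir M v u

record Cycle {m n} (M : BinMatrix m n) (L : ℕ) : Set where
  field
    len≥3 : 3 ≤ L
    vtx   : Fin L → Vertex n
    inj   : Injective _≡_ _≡_ vtx
    adj   : ∀ (i j : Fin L) →
            (suc (toℕ i) ≡ toℕ j) ⊎ ((suc (toℕ i) ≡ L) × (toℕ j ≡ 0)) →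
            Adj M (vtx i) (vtx j)

Odd : ℕ → Set
Odd L = ¬ (2 ∣ L)

SmallestOddCycleLength : ∀ {m n} → BinMatrix m n → ℕ → Set
SmallestOddCycleLength M ℓ =
  (Odd ℓ × Cycle M ℓ) × (∀ L → Odd L → Cycle M L → ℓ ≤ L)

-- The matrix T_{II_k}, 0-indexed rows/columns:
--   rows r = 0 … k-3 : 1 exactly in columns r and r+1;
--   row k-2          : 1 exactly in all columns except column k-2;
--   row k-1          : 1 exactly in all columns except column 0.
T-II : (k : ℕ) → BinMatrix k k
T-II k r c =
  if ⌊ toℕ r + 2 <? k ⌋
  then (⌊ toℕ c ≟ toℕ r ⌋ ∨ ⌊ toℕ c ≟ suc (toℕ r) ⌋)
  else (if ⌊ toℕ r ≟ k ∸ 2 ⌋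
        then not ⌊ toℕ c ≟ k ∸ 2 ⌋
        else not ⌊ toℕ c ≟ 0 ⌋)

-- Write k = n + 4, p = k - 2, q = k - 1 (columns and rows indexed from 0).
--
-- We fold G_T onto a circulant graph on ℕ by an explicit
-- labelling of the vertices (i , j): (q , j) and (i , q) get labels b j and
-- a i depending on the parity of the index, (p , j) gets a constant c, and the
-- remaining vertices only record whether i > j.  A classification of the edges
-- of G_T (`edge-shape`) shows that this is a homomorphism into the cycle C_k
-- when k is odd, and into the Möbius ladder Circ(2k; ±1, ±k) when k is even.
-- A cycle of G_T becomes a closed walk there, and a winding-number count
-- (`Balance`) shows that odd closed walks in these graphs have length ≥ k,
-- resp. ≥ k + 1.
--
-- The walk (0 , p), (q , 0), (1 , q), (q , 2), (3 , q), …
-- alternates around column q using the band rows; it closes up after k steps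
-- at (p , q) when k is odd, and after k + 1 steps via (q , p), (p , 0) when k is
-- even.  `cycle-from-pairs` turns such a numeric description into a Cycle.

module Submission where

open import Defs
open import Data.Nat using (ℕ; suc; _≤_)
open import Data.Nat.Divisibility using (_∣_)
open import Data.Product using (_×_)
open import Relation.Nullary using (¬_)

open import Data.Nat using (zero; _+_; _*_; _∸_; _<_; _<?_; z≤n; s≤s; s≤s⁻¹)
open import Data.Nat.Properties
open import Data.Nat.Divisibility using (divides; ∣-refl; ∣1⇒≡1; ∣m∣n⇒∣m+n; ∣m+n∣m⇒∣n)
open import Data.Nat.Tactic.RingSolver using (solve-∀; solve)
open import Data.List using ([]; _∷_)
open import Data.Fin using (Fin; toℕ; fromℕ<)
open import Data.Fin.Properties using (toℕ-fromℕ<; toℕ-injective; toℕ<n)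
open import Data.Bool using (Bool; true; false; if_then_else_; _∨_; not)
open import Data.Bool.Properties using (not-involutive)
open import Data.Product using (_,_; proj₁; proj₂; ∃-syntax)
open import Data.Sum using (_⊎_; inj₁; inj₂; [_,_]′)
open import Data.Empty using (⊥; ⊥-elim)
open import Data.Unit using (⊤; tt)
open import Function using (_∘_)
open import Relation.Nullary using (Dec; yes; no; contradiction)
open import Relation.Nullary.Decidable using (⌊_⌋; decidable-stable; _⊎-dec_)
open import Relation.Binary.Definitions using (Tri; tri<; tri≈; tri>)
open import Relation.Binary.PropositionalEquality

-- Edges of the circulant graph Circ(N; ±1, ±κ), drawn on ℕ: the vertex x is
-- joined to x ± 1, to x + 1 - N and x - 1 + N (going once around the cycle),
-- and, when `Chords` is inhabited, to x ± κ.
data Step (Chords : Set) (N κ : ℕ) (x y : ℕ) : Set where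
  forward      : y ≡ suc x → Step Chords N κ x y
  backward     : x ≡ suc y → Step Chords N κ x y
  wrapForward  : suc x ≡ y + N → Step Chords N κ x y
  wrapBackward : suc y ≡ x + N → Step Chords N κ x y
  chordForward  : Chords → y ≡ x + κ → Step Chords N κ x y
  chordBackward : Chords → x ≡ y + κ → Step Chords N κ x y

step-sym : ∀ {C N κ x y} → Step C N κ x y → Step C N κ y x
step-sym (forward e)         = backward e
step-sym (backward e)        = forward e
step-sym (wrapForward e)     = wrapBackward e
step-sym (wrapBackward e)    = wrapForward e
step-sym (chordForward c e)  = chordBackward c e
step-sym (chordBackward c e) = chordForward c e

record ClosedWalk (R : ℕ → ℕ → Set) (L : ℕ) : Set where
  field
    point  : ℕ → ℕ
    steps  : ∀ t → t < L → R (point t) (point (suc t))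
    closed : point L ≡ point 0

-- How many steps of each kind a walk in Circ(N; ±1, ±κ) uses; the
-- wrap-around steps are counted both among the unit steps and separately.
record Tally : Set where
  constructor tally
  field
    ups downs wrapUps wrapDowns chordUps chordDowns : ℕ
open Tally

_⊕_ : Tally → Tally → Tally
tally a b c d e f ⊕ tally a′ b′ c′ d′ e′ f′ =
  tally (a + a′) (b + b′) (c + c′) (d + d′) (e + e′) (f + f′)

-- The number of steps, and the total displacement forward and backward (a
-- chord moves by κ, a wrap-around step moves back resp. forward by N).
stepCount : Tally → ℕ
stepCount T = ups T + downs T + chordUps T + chordDowns T

ahead behind : ℕ → ℕ → Tally → ℕ
ahead  N κ T = ups T + κ * chordUps T + N * wrapDowns T
behind N κ T = downs T + κ * chordDowns T + N * wrapUps T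

stepCount-⊕ : ∀ T U → stepCount (T ⊕ U) ≡ stepCount T + stepCount U
stepCount-⊕ (tally a b _ _ e f) (tally a′ b′ _ _ e′ f′) = regroup a b e f a′ b′ e′ f′
  where
  regroup : ∀ a b e f a′ b′ e′ f′ →
            (a + a′) + (b + b′) + (e + e′) + (f + f′) ≡ (a + b + e + f) + (a′ + b′ + e′ + f′)
  regroup = solve-∀

ahead-⊕ : ∀ N κ T U → ahead N κ (T ⊕ U) ≡ ahead N κ T + ahead N κ U
ahead-⊕ N κ (tally a _ _ d e _) (tally a′ _ _ d′ e′ _) = regroup N κ a d e a′ d′ e′
  where
  regroup : ∀ N κ a d e a′ d′ e′ →
            (a + a′) + κ * (e + e′) + N * (d + d′) ≡ (a + κ * e + N * d) + (a′ + κ * e′ + N * d′)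
  regroup = solve-∀

behind-⊕ : ∀ N κ T U → behind N κ (T ⊕ U) ≡ behind N κ T + behind N κ U
behind-⊕ N κ (tally _ b c _ _ f) (tally _ b′ c′ _ _ f′) = regroup N κ b c f b′ c′ f′
  where
  regroup : ∀ N κ b c f b′ c′ f′ →
            (b + b′) + κ * (f + f′) + N * (c + c′) ≡ (b + κ * f + N * c) + (b′ + κ * f′ + N * c′)
  regroup = solve-∀

stepTally : ∀ {C N κ x y} → Step C N κ x y → Tally
stepTally (forward _)         = tally 1 0 0 0 0 0
stepTally (backward _)        = tally 0 1 0 0 0 0
stepTally (wrapForward _)     = tally 1 0 1 0 0 0
stepTally (wrapBackward _)    = tally 0 1 0 1 0 0
stepTally (chordForward _ _)  = tally 0 0 0 0 1 0
stepTally (chordBackward _ _) = tally 0 0 0 0 0 1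

stepTally-count : ∀ {C N κ x y} (s : Step C N κ x y) → stepCount (stepTally s) ≡ 1
stepTally-count (forward _)         = refl
stepTally-count (backward _)        = refl
stepTally-count (wrapForward _)     = refl
stepTally-count (wrapBackward _)    = refl
stepTally-count (chordForward _ _)  = refl
stepTally-count (chordBackward _ _) = refl

stepTally-displaced : ∀ {C N κ x y} (s : Step C N κ x y) →
                      y + behind N κ (stepTally s) ≡ x + ahead N κ (stepTally s)
stepTally-displaced {N = N} {κ} {x} (forward refl) = begin
  suc x + (0 + κ * 0 + N * 0)      ≡⟨ solve (x ∷ N ∷ κ ∷ []) ⟩
  x + (1 + κ * 0 + N * 0)          ∎
  where open ≡-Reasoning
stepTally-displaced {N = N} {κ} {y = y} (backward refl) = begin
  y + (1 + κ * 0 + N * 0)          ≡⟨ solve (y ∷ N ∷ κ ∷ []) ⟩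
  suc y + (0 + κ * 0 + N * 0)      ∎
  where open ≡-Reasoning
stepTally-displaced {N = N} {κ} {x} {y} (wrapForward e) = begin
  y + (0 + κ * 0 + N * 1)          ≡⟨ solve (y ∷ N ∷ κ ∷ []) ⟩
  y + N                            ≡⟨ e ⟨
  suc x                            ≡⟨ solve (x ∷ N ∷ κ ∷ []) ⟩
  x + (1 + κ * 0 + N * 0)          ∎
  where open ≡-Reasoning
stepTally-displaced {N = N} {κ} {x} {y} (wrapBackward e) = begin
  y + (1 + κ * 0 + N * 0)          ≡⟨ solve (y ∷ N ∷ κ ∷ []) ⟩
  suc y                            ≡⟨ e ⟩
  x + N                            ≡⟨ solve (x ∷ N ∷ κ ∷ []) ⟩
  x + (0 + κ * 0 + N * 1)          ∎
  where open ≡-Reasoning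
stepTally-displaced {N = N} {κ} {x} (chordForward _ refl) = begin
  x + κ + (0 + κ * 0 + N * 0)      ≡⟨ solve (x ∷ N ∷ κ ∷ []) ⟩
  x + (0 + κ * 1 + N * 0)          ∎
  where open ≡-Reasoning
stepTally-displaced {N = N} {κ} {y = y} (chordBackward _ refl) = begin
  y + (0 + κ * 1 + N * 0)          ≡⟨ solve (y ∷ N ∷ κ ∷ []) ⟩
  y + κ + (0 + κ * 0 + N * 0)      ∎
  where open ≡-Reasoning

stepTally-chordFree : ∀ {C N κ x y} (s : Step C N κ x y) →
                      C ⊎ (chordUps (stepTally s) ≡ 0 × chordDowns (stepTally s) ≡ 0)
stepTally-chordFree (forward _)         = inj₂ (refl , refl)
stepTally-chordFree (backward _)        = inj₂ (refl , refl)
stepTally-chordFree (wrapForward _)     = inj₂ (refl , refl)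
stepTally-chordFree (wrapBackward _)    = inj₂ (refl , refl)
stepTally-chordFree (chordForward c _)  = inj₁ c
stepTally-chordFree (chordBackward c _) = inj₁ c

record Balance (Chords : Set) (N κ g₀ g t : ℕ) : Set where
  field
    used      : Tally
    length    : stepCount used ≡ t
    displaced : g + behind N κ used ≡ g₀ + ahead N κ used
    chordFree : Chords ⊎ (chordUps used ≡ 0 × chordDowns used ≡ 0)
open Balance

balance-nil : ∀ {C N κ g₀} → Balance C N κ g₀ g₀ 0
balance-nil = record
  { used = tally 0 0 0 0 0 0 ; length = refl ; displaced = refl ; chordFree = inj₂ (refl , refl) }

balance-snoc : ∀ {C N κ g₀ x y t} → Balance C N κ g₀ x t → Step C N κ x y →
               Balance C N κ g₀ y (suc t)
balance-snoc {C} {N} {κ} {g₀} {x} {y} {t} B s = record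
  { used = T ⊕ S
  ; length = begin
      stepCount (T ⊕ S)            ≡⟨ stepCount-⊕ T S ⟩
      stepCount T + stepCount S    ≡⟨ cong₂ _+_ (length B) (stepTally-count s) ⟩
      t + 1                        ≡⟨ +-comm t 1 ⟩
      suc t                        ∎
  ; displaced = begin
      y + behind N κ (T ⊕ S)               ≡⟨ cong (y +_) (behind-⊕ N κ T S) ⟩
      y + (behind N κ T + behind N κ S)    ≡⟨ swap y (behind N κ T) (behind N κ S) ⟩
      (y + behind N κ S) + behind N κ T    ≡⟨ cong (_+ behind N κ T) (stepTally-displaced s) ⟩
      (x + ahead N κ S) + behind N κ T     ≡⟨ swap′ x (ahead N κ S) (behind N κ T) ⟩
      (x + behind N κ T) + ahead N κ S     ≡⟨ cong (_+ ahead N κ S) (displaced B) ⟩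
      (g₀ + ahead N κ T) + ahead N κ S     ≡⟨ +-assoc g₀ (ahead N κ T) (ahead N κ S) ⟩
      g₀ + (ahead N κ T + ahead N κ S)     ≡⟨ cong (g₀ +_) (ahead-⊕ N κ T S) ⟨
      g₀ + ahead N κ (T ⊕ S)               ∎
  ; chordFree = both (chordFree B) (stepTally-chordFree s) }
  where
  open ≡-Reasoning
  T S : Tally
  T = used B
  S = stepTally s
  swap : ∀ y a b → y + (a + b) ≡ (y + b) + a
  swap = solve-∀
  swap′ : ∀ x a b → (x + a) + b ≡ (x + b) + a
  swap′ = solve-∀
  both : C ⊎ (chordUps T ≡ 0 × chordDowns T ≡ 0) → C ⊎ (chordUps S ≡ 0 × chordDowns S ≡ 0) →
         C ⊎ (chordUps (T ⊕ S) ≡ 0 × chordDowns (T ⊕ S) ≡ 0)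
  both (inj₁ c) _ = inj₁ c
  both (inj₂ _) (inj₁ c) = inj₁ c
  both (inj₂ (u₀ , d₀)) (inj₂ (u₀′ , d₀′)) = inj₂ (cong₂ _+_ u₀ u₀′ , cong₂ _+_ d₀ d₀′)

closedWalk-balance : ∀ {C N κ L} (W : ClosedWalk (Step C N κ) L) →
                     let open ClosedWalk W in Balance C N κ (point 0) (point 0) L
closedWalk-balance {C} {N} {κ} {L} W =
  subst (λ g → Balance C N κ (point 0) g L) closed (prefix L ≤-refl)
  where
  open ClosedWalk W
  prefix : ∀ t → t ≤ L → Balance C N κ (point 0) (point t) t
  prefix zero    _ = balance-nil
  prefix (suc t) h = balance-snoc (prefix t (<⇒≤ h)) (steps t h)

offset-multiples : ∀ m p κ X Y → m + X * κ ≡ p + Y * κ →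
                   (X ≡ Y × m ≡ p) ⊎ (κ ≤ m ⊎ κ ≤ p)
offset-multiples m p κ zero zero e =
  inj₁ (refl , trans (sym (+-identityʳ m)) (trans e (+-identityʳ p)))
offset-multiples m p κ zero (suc Y) e =
  inj₂ (inj₁ (≤-trans (≤-trans (m≤m+n κ (Y * κ)) (m≤n+m _ p))
                      (≤-reflexive (sym (trans (sym (+-identityʳ m)) e)))))
offset-multiples m p κ (suc X) zero e =
  inj₂ (inj₂ (≤-trans (≤-trans (m≤m+n κ (X * κ)) (m≤n+m _ m))
                      (≤-reflexive (trans e (+-identityʳ p)))))
offset-multiples m p κ (suc X) (suc Y) e
  with offset-multiples m p κ X Y
         (+-cancelʳ-≡ κ _ _ (trans (regroup m κ (X * κ)) (trans e (sym (regroup p κ (Y * κ))))))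
  where
  regroup : ∀ m κ r → m + r + κ ≡ m + (κ + r)
  regroup = solve-∀
... | inj₁ (refl , m≡p) = inj₁ (refl , m≡p)
... | inj₂ big          = inj₂ big

-- Winding number argument on Circ(N; ±1): if u forward and d backward unit
-- moves return to the start (d + wᵤ·N = u + w_d·N), then either u = d and the
-- walk has even length, or the walk winds around and has length at least N.
cycle-count : ∀ N u d wᵤ w_d → d + wᵤ * N ≡ u + w_d * N → ¬ (2 ∣ u + d) → N ≤ u + d
cycle-count N u d wᵤ w_d balanced odd with offset-multiples d u N wᵤ w_d balanced
... | inj₁ (_ , refl)  = ⊥-elim (odd (divides u (solve (u ∷ []))))
... | inj₂ (inj₁ N≤d) = ≤-trans N≤d (m≤n+m d u)
... | inj₂ (inj₂ N≤u) = ≤-trans N≤u (m≤m+n u d)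

-- The same argument on Circ(2κ; ±1, ±κ) with κ even: a chord counts as half a
-- turn, so a closed walk either uses no net unit moves (u = d) and then has even
-- length, or has at least κ unit moves in one direction; κ itself is even, so an
-- odd closed walk has length at least κ + 1.
möbius-count : ∀ κ u d cᵤ c_d wᵤ w_d →
               d + (wᵤ + wᵤ + c_d) * κ ≡ u + (cᵤ + w_d + w_d) * κ →
               ¬ (2 ∣ u + d + cᵤ + c_d) → 2 ∣ κ → suc κ ≤ u + d + cᵤ + c_d
möbius-count κ u d cᵤ c_d wᵤ w_d balanced odd κ-even
  with offset-multiples d u κ (wᵤ + wᵤ + c_d) (cᵤ + w_d + w_d) balanced
... | inj₁ (turns , refl) = ⊥-elim (odd (∣m+n∣m⇒∣n (divides (u + c_d + wᵤ) even) (doubled w_d)))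
  where
  open ≡-Reasoning
  doubled : ∀ w → 2 ∣ w + w
  doubled w = divides w (solve (w ∷ []))
  even : (w_d + w_d) + (u + u + cᵤ + c_d) ≡ (u + c_d + wᵤ) * 2
  even = begin
    (w_d + w_d) + (u + u + cᵤ + c_d)  ≡⟨ solve (w_d ∷ u ∷ cᵤ ∷ c_d ∷ []) ⟩
    (u + u + c_d) + (cᵤ + w_d + w_d)  ≡⟨ cong ((u + u + c_d) +_) turns ⟨
    (u + u + c_d) + (wᵤ + wᵤ + c_d)   ≡⟨ solve (u ∷ c_d ∷ wᵤ ∷ []) ⟩
    (u + c_d + wᵤ) * 2                ∎
... | inj₂ big = ≤∧≢⇒< κ≤length (λ κ≡length → odd (subst (2 ∣_) κ≡length κ-even))
  where
  κ≤length : κ ≤ u + d + cᵤ + c_d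
  κ≤length = ≤-trans ([ (λ κ≤d → ≤-trans κ≤d (m≤n+m d u)) , (λ κ≤u → ≤-trans κ≤u (m≤m+n u d)) ]′ big)
                     (≤-trans (m≤m+n (u + d) cᵤ) (m≤m+n (u + d + cᵤ) c_d))

oddClosedWalk-cycleGraph : ∀ {N κ L} → ClosedWalk (Step ⊥ N κ) L → ¬ (2 ∣ L) → N ≤ L
oddClosedWalk-cycleGraph {N} {κ} {L} W odd with closedWalk-balance W
... | record { used = tally u d wᵤ w_d _ _ ; length = len ; displaced = disp ; chordFree = inj₂ (refl , refl) } =
  subst (N ≤_) len′ (cycle-count N u d wᵤ w_d balanced (λ 2∣ → odd (subst (2 ∣_) len′ 2∣)))
  where
  open ≡-Reasoning
  len′ : u + d ≡ L
  len′ = begin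
    u + d                     ≡⟨ solve (u ∷ d ∷ []) ⟩
    u + d + 0 + 0             ≡⟨ len ⟩
    L                         ∎
  balanced : d + wᵤ * N ≡ u + w_d * N
  balanced = begin
    d + wᵤ * N                ≡⟨ solve (d ∷ wᵤ ∷ N ∷ κ ∷ []) ⟩
    d + κ * 0 + N * wᵤ        ≡⟨ +-cancelˡ-≡ (ClosedWalk.point W 0) _ _ disp ⟩
    u + κ * 0 + N * w_d       ≡⟨ solve (u ∷ κ ∷ N ∷ w_d ∷ []) ⟩
    u + w_d * N               ∎

oddClosedWalk-möbius : ∀ {C κ L} → ClosedWalk (Step C (κ + κ) κ) L → ¬ (2 ∣ L) → 2 ∣ κ → suc κ ≤ L
oddClosedWalk-möbius {C} {κ} {L} W odd κ-even with closedWalk-balance W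
... | record { used = tally u d wᵤ w_d cᵤ c_d ; length = len ; displaced = disp } =
  subst (suc κ ≤_) len (möbius-count κ u d cᵤ c_d wᵤ w_d balanced (λ 2∣ → odd (subst (2 ∣_) len 2∣)) κ-even)
  where
  open ≡-Reasoning
  balanced : d + (wᵤ + wᵤ + c_d) * κ ≡ u + (cᵤ + w_d + w_d) * κ
  balanced = begin
    d + (wᵤ + wᵤ + c_d) * κ         ≡⟨ solve (d ∷ wᵤ ∷ c_d ∷ κ ∷ []) ⟩
    d + κ * c_d + (κ + κ) * wᵤ      ≡⟨ +-cancelˡ-≡ (ClosedWalk.point W 0) _ _ disp ⟩
    u + κ * cᵤ + (κ + κ) * w_d      ≡⟨ solve (u ∷ κ ∷ cᵤ ∷ w_d ∷ []) ⟩
    u + (cᵤ + w_d + w_d) * κ        ∎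

cycle⇒closedWalk : ∀ {m n L} {M : BinMatrix m n} {R : ℕ → ℕ → Set} (f : Vertex n → ℕ) →
                   (∀ u v → Adj M u v → R (f u) (f v)) → Cycle M L → ClosedWalk R L
cycle⇒closedWalk {L = L} {R = R} f hom C = record
  { point = λ t → f (vtx (index t))
  ; steps = step
  ; closed = cong (λ i → f (vtx i)) (toℕ-injective (trans index-L (sym (index-< 0<L)))) }
  where
  open Cycle C
  0<L : 0 < L
  0<L = ≤-trans (s≤s z≤n) len≥3

  -- the t-th vertex of the walk, read cyclically (only t ≤ L is used)
  index : ℕ → Fin L
  index t with t <? L
  ... | yes t<L = fromℕ< t<L
  ... | no  _   = fromℕ< 0<L

  index-< : ∀ {t} → t < L → toℕ (index t) ≡ t
  index-< {t} t<L with t <? L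
  ... | yes _   = toℕ-fromℕ< _
  ... | no  t≮L = contradiction t<L t≮L

  index-L : toℕ (index L) ≡ 0
  index-L with L <? L
  ... | yes L<L = contradiction L<L (<-irrefl refl)
  ... | no  _   = toℕ-fromℕ< _

  step : ∀ t → t < L → R (f (vtx (index t))) (f (vtx (index (suc t))))
  step t t<L with m≤n⇒m<n∨m≡n t<L
  ... | inj₁ t+1<L = hom _ _ (adj _ _ (inj₁ (trans (cong suc (index-< t<L)) (sym (index-< t+1<L)))))
  ... | inj₂ t+1≡L = hom _ _ (adj _ _ (inj₂ (trans (cong suc (index-< t<L)) t+1≡L
                                           , subst (λ s → toℕ (index s) ≡ 0) (sym t+1≡L) index-L)))

fromEntries : ∀ {m n} → (ℕ → ℕ → Bool) → BinMatrix m n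
fromEntries E r c = E (toℕ r) (toℕ c)

Incompatible : ℕ → (ℕ → ℕ → Bool) → ℕ → ℕ → ℕ → Set
Incompatible rows E i j m =
  i ≡ m ⊎ ∃[ r ] (r < rows × E r i ≡ true × E r m ≡ true × E r j ≡ false)

adjDir⇒incompatible : ∀ {m n E} {u v : Vertex n} → AdjDir (fromEntries {m} E) u v →
                      Incompatible m E (toℕ (fstC u)) (toℕ (sndC u)) (toℕ (sndC v))
adjDir⇒incompatible (_ , inj₁ i≡m)               = inj₁ (cong toℕ i≡m)
adjDir⇒incompatible (_ , inj₂ (r , ri , rm , rj)) = inj₂ (toℕ r , toℕ<n r , ri , rm , rj)

incompatible⇒adjDir : ∀ {m n E} {u v : Vertex n} → toℕ (sndC u) ≡ toℕ (fstC v) →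
                      Incompatible m E (toℕ (fstC u)) (toℕ (sndC u)) (toℕ (sndC v)) →
                      AdjDir (fromEntries {m} E) u v
incompatible⇒adjDir j≡j (inj₁ i≡m) = toℕ-injective j≡j , inj₁ (toℕ-injective i≡m)
incompatible⇒adjDir {E = E} {u} {v} j≡j (inj₂ (r , r<m , row)) =
  toℕ-injective j≡j , inj₂ (fromℕ< r<m , subst Pattern (sym (toℕ-fromℕ< r<m)) row)
  where
  Pattern : ℕ → Set
  Pattern x = E x (toℕ (fstC u)) ≡ true × E x (toℕ (sndC v)) ≡ true × E x (toℕ (sndC u)) ≡ false

Adjacentℕ : ℕ → (ℕ → ℕ → Bool) → ℕ × ℕ → ℕ × ℕ → Set
Adjacentℕ rows E (i , j) (i′ , j′) =
  (j ≡ i′ × Incompatible rows E i j j′) ⊎ (j′ ≡ i × Incompatible rows E i′ j′ j)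

record ValidPair (n : ℕ) (ij : ℕ × ℕ) : Set where
  field
    fst< : proj₁ ij < n
    snd< : proj₂ ij < n
    fst≢snd : proj₁ ij ≢ proj₂ ij

toVertex : ∀ {n ij} → ValidPair n ij → Vertex n
toVertex v = (fromℕ< fst< , fromℕ< snd<) ,
             λ e → fst≢snd (trans (sym (toℕ-fromℕ< fst<)) (trans (cong toℕ e) (toℕ-fromℕ< snd<)))
  where open ValidPair v

-- A cycle of G_M described by numeric column pairs pr 0, …, pr (L - 1): the
-- pairs must be valid, recoverable from their position (so pairwise distinct),
-- and consecutive pairs (cyclically) adjacent.
cycle-from-pairs : ∀ {rows n L} {E : ℕ → ℕ → Bool} (pr : ℕ → ℕ × ℕ) (position : ℕ × ℕ → ℕ) →
  3 ≤ L →
  (∀ t → t < L → ValidPair n (pr t)) →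
  (∀ t → t < L → position (pr t) ≡ t) →
  (∀ t → suc t < L → Adjacentℕ rows E (pr t) (pr (suc t))) →
  (∀ t → suc t ≡ L → Adjacentℕ rows E (pr t) (pr 0)) →
  Cycle (fromEntries {rows} {n} E) L
cycle-from-pairs {rows} {n} {L} {E} pr position 3≤L valid recover next close = record
  { len≥3 = 3≤L
  ; vtx = vertex
  ; inj = λ {i} {j} e → toℕ-injective (trans (sym (recover (toℕ i) (toℕ<n i)))
                          (trans (cong position (pair-cong e)) (recover (toℕ j) (toℕ<n j))))
  ; adj = adjacent }
  where
  vertex : Fin L → Vertex n
  vertex i = toVertex (valid (toℕ i) (toℕ<n i))

  fst-vertex : ∀ i → toℕ (fstC (vertex i)) ≡ proj₁ (pr (toℕ i))
  fst-vertex i = toℕ-fromℕ< _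

  snd-vertex : ∀ i → toℕ (sndC (vertex i)) ≡ proj₂ (pr (toℕ i))
  snd-vertex i = toℕ-fromℕ< _

  pair-cong : ∀ {i j} → vertex i ≡ vertex j → pr (toℕ i) ≡ pr (toℕ j)
  pair-cong {i} {j} e = cong₂ _,_
    (trans (sym (fst-vertex i)) (trans (cong (λ v → toℕ (fstC v)) e) (fst-vertex j)))
    (trans (sym (snd-vertex i)) (trans (cong (λ v → toℕ (sndC v)) e) (snd-vertex j)))

  directed : ∀ i j → proj₂ (pr (toℕ i)) ≡ proj₁ (pr (toℕ j)) →
             Incompatible rows E (proj₁ (pr (toℕ i))) (proj₂ (pr (toℕ i))) (proj₂ (pr (toℕ j))) →
             AdjDir (fromEntries E) (vertex i) (vertex j)
  directed i j linked inc = incompatible⇒adjDir {m = rows} {E = E} {vertex i} {vertex j} link shape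
    where
    link : toℕ (sndC (vertex i)) ≡ toℕ (fstC (vertex j))
    link rewrite snd-vertex i | fst-vertex j = linked
    shape : Incompatible rows E (toℕ (fstC (vertex i))) (toℕ (sndC (vertex i))) (toℕ (sndC (vertex j)))
    shape rewrite fst-vertex i | snd-vertex i | snd-vertex j = inc

  lift : ∀ i j → Adjacentℕ rows E (pr (toℕ i)) (pr (toℕ j)) → Adj (fromEntries E) (vertex i) (vertex j)
  lift i j (inj₁ (linked , inc)) = inj₁ (directed i j linked inc)
  lift i j (inj₂ (linked , inc)) = inj₂ (directed j i linked inc)

  adjacent : ∀ i j → (suc (toℕ i) ≡ toℕ j) ⊎ ((suc (toℕ i) ≡ L) × (toℕ j ≡ 0)) →
             Adj (fromEntries E) (vertex i) (vertex j)
  adjacent i j (inj₁ i+1≡j) =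
    lift i j (subst (λ t → Adjacentℕ rows E (pr (toℕ i)) (pr t)) i+1≡j (next (toℕ i) (subst (_< L) (sym i+1≡j) (toℕ<n j))))
  adjacent i j (inj₂ (i+1≡L , j≡0)) =
    lift i j (subst (λ t → Adjacentℕ rows E (pr (toℕ i)) (pr t)) (sym j≡0) (close (toℕ i) i+1≡L))

odd : ℕ → Bool
odd zero    = false
odd (suc n) = not (odd n)

parity : ∀ x → (odd x ≡ true × ¬ (2 ∣ x)) ⊎ (odd x ≡ false × 2 ∣ x)
parity zero          = inj₂ (refl , divides 0 refl)
parity (suc zero)    = inj₁ (refl , λ 2∣1 → contradiction (∣1⇒≡1 2∣1) (λ ()))
parity (suc (suc x)) with parity x
... | inj₁ (odd-x , 2∤x)  = inj₁ (trans (not-involutive (odd x)) odd-x , λ 2∣x+2 → 2∤x (∣m+n∣m⇒∣n 2∣x+2 ∣-refl))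
... | inj₂ (even-x , 2∣x) = inj₂ (trans (not-involutive (odd x)) even-x , ∣m∣n⇒∣m+n ∣-refl 2∣x)

-- The entries of T_{II_k} on numeric indices: T-II k is fromEntries (entry k).
entry : ℕ → ℕ → ℕ → Bool
entry k r c =
  if ⌊ r + 2 <? k ⌋
  then (⌊ c ≟ r ⌋ ∨ ⌊ c ≟ suc r ⌋)
  else (if ⌊ r ≟ k ∸ 2 ⌋
        then not ⌊ c ≟ k ∸ 2 ⌋
        else not ⌊ c ≟ 0 ⌋)

module Shape (n : ℕ) where
  p q k : ℕ
  p = 2 + n
  q = 3 + n
  k = 4 + n

  true≢false : true ≢ false
  true≢false ()

  p≢q : p ≢ q
  p≢q p≡q = <-irrefl p≡q (n<1+n p)

  q<k : q < k
  q<k = n<1+n q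

  p<k : p < k
  p<k = <-trans (n<1+n p) q<k

  q≢0 : q ≢ 0
  q≢0 ()

  p≢0 : p ≢ 0
  p≢0 ()

  -- k = p + 2 has the parity of p.
  odd-p : ¬ (2 ∣ k) → odd p ≡ true
  odd-p 2∤k with parity p
  ... | inj₁ (p-odd , _) = p-odd
  ... | inj₂ (_ , 2∣p)   = contradiction (∣m∣n⇒∣m+n ∣-refl 2∣p) 2∤k

  even-p : 2 ∣ k → odd p ≡ false
  even-p 2∣k with parity p
  ... | inj₁ (_ , 2∤p)   = contradiction (∣m+n∣m⇒∣n 2∣k ∣-refl) 2∤p
  ... | inj₂ (p-even , _) = p-even

  band-in : ∀ {r c} → r + 2 < k → c ≡ r ⊎ c ≡ suc r → entry k r c ≡ true
  band-in {r} {c} band c∈ with r + 2 <? k | c ≟ r | c ≟ suc r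
  ... | no ¬band | _ | _             = contradiction band ¬band
  ... | yes _ | yes _ | _             = refl
  ... | yes _ | no _ | yes _          = refl
  ... | yes _ | no c≢r | no c≢r+1     = ⊥-elim ([ c≢r , c≢r+1 ]′ c∈)

  band-out : ∀ {r c} → r + 2 < k → c ≢ r → c ≢ suc r → entry k r c ≡ false
  band-out {r} {c} band c≢r c≢r+1 with r + 2 <? k | c ≟ r | c ≟ suc r
  ... | no ¬band | _ | _      = contradiction band ¬band
  ... | yes _ | yes c≡r | _   = contradiction c≡r c≢r
  ... | yes _ | no _ | yes e  = contradiction e c≢r+1
  ... | yes _ | no _ | no _   = refl

  p-row : ∀ c → entry k p c ≡ not ⌊ c ≟ p ⌋
  p-row c with p + 2 <? k | p ≟ p
  ... | yes p+2<k | _   = contradiction p+2<k (<-irrefl (+-comm p 2))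
  ... | no _ | yes _    = refl
  ... | no _ | no p≢p   = contradiction refl p≢p

  q-row : ∀ c → entry k q c ≡ not ⌊ c ≟ 0 ⌋
  q-row c with q + 2 <? k | q ≟ p
  ... | yes q+2<k | _   = contradiction (≤-trans (n≤1+n k) (≤-reflexive (+-comm 2 q))) (<⇒≱ q+2<k)
  ... | no _ | yes q≡p  = contradiction (sym q≡p) p≢q
  ... | no _ | no _     = refl

  p-row-one : ∀ {c} → c ≢ p → entry k p c ≡ true
  p-row-one {c} c≢p rewrite p-row c with c ≟ p
  ... | yes c≡p = contradiction c≡p c≢p
  ... | no _    = refl

  p-row-diag : entry k p p ≡ false
  p-row-diag rewrite p-row p with p ≟ p
  ... | yes _   = refl
  ... | no p≢p  = contradiction refl p≢p

  q-row-one : ∀ {c} → c ≢ 0 → entry k q c ≡ true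
  q-row-one {c} c≢0 rewrite q-row c with c ≟ 0
  ... | yes c≡0 = contradiction c≡0 c≢0
  ... | no _    = refl

  q-row-0 : entry k q 0 ≡ false
  q-row-0 rewrite q-row 0 = refl

  band-support : ∀ {r c} → r + 2 < k → entry k r c ≡ true → c ≡ r ⊎ c ≡ suc r
  band-support {r} {c} band one = decidable-stable ((c ≟ r) ⊎-dec (c ≟ suc r)) λ c∉ →
    true≢false (trans (sym one) (band-out band (c∉ ∘ inj₁) (c∉ ∘ inj₂)))

  p-row-zero : ∀ {c} → entry k p c ≡ false → c ≡ p
  p-row-zero {c} off = decidable-stable (c ≟ p) λ c≢p → true≢false (trans (sym (p-row-one c≢p)) off)

  q-row-zero : ∀ {c} → entry k q c ≡ false → c ≡ 0
  q-row-zero {c} off = decidable-stable (c ≟ 0) λ c≢0 → true≢false (trans (sym (q-row-one c≢0)) off)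

  row-kind : ∀ {r} → r < k → r + 2 < k ⊎ (r ≡ p ⊎ r ≡ q)
  row-kind {r} r<k with r + 2 <? k | r ≟ p
  ... | yes band | _     = inj₁ band
  ... | no _ | yes r≡p   = inj₂ (inj₁ r≡p)
  ... | no ¬band | no r≢p = inj₂ (inj₂ (≤-antisym (s≤s⁻¹ r<k) (≤∧≢⇒< p≤r (λ p≡r → r≢p (sym p≡r)))))
    where
    p≤r : p ≤ r
    p≤r = s≤s⁻¹ (s≤s⁻¹ (≤-trans (≮⇒≥ ¬band) (≤-reflexive (+-comm r 2))))

  data EdgeShape (i j m : ℕ) : Set where
    returning : i ≡ m → EdgeShape i j m
    through0  : j ≡ 0 → EdgeShape i j m
    throughP  : j ≡ p → EdgeShape i j m
    stepUp    : m ≡ suc i → m < q → EdgeShape i j m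
    stepDown  : i ≡ suc m → i < q → EdgeShape i j m

  -- Row p can only separate through column p, row q through column 0, and a
  -- band row r only joins (r , j) and (j , r + 1) (or the reverse).
  edge-shape : ∀ {i j m} → Incompatible k (entry k) i j m → EdgeShape i j m
  edge-shape (inj₁ i≡m) = returning i≡m
  edge-shape {i} {j} {m} (inj₂ (r , r<k , ri , rm , rj)) with row-kind r<k
  ... | inj₂ (inj₁ refl) = throughP (p-row-zero rj)
  ... | inj₂ (inj₂ refl) = through0 (q-row-zero rj)
  ... | inj₁ band = band-shape (band-support band ri) (band-support band rm)
    where
    r+1<q : suc r < q
    r+1<q = s≤s⁻¹ (≤-trans (≤-reflexive (+-comm 2 (suc r))) band)
    band-shape : i ≡ r ⊎ i ≡ suc r → m ≡ r ⊎ m ≡ suc r → EdgeShape i j m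
    band-shape (inj₁ refl) (inj₁ refl) = returning refl
    band-shape (inj₂ refl) (inj₂ refl) = returning refl
    band-shape (inj₁ refl) (inj₂ refl) = stepUp refl r+1<q
    band-shape (inj₂ refl) (inj₁ refl) = stepDown refl r+1<q

  module Labels (a b : ℕ → ℕ) (c : ℕ) where
    label : ℕ → ℕ → ℕ
    label i j =
      if ⌊ i ≟ q ⌋ then b j
      else if ⌊ j ≟ q ⌋ then a i
      else if ⌊ i ≟ p ⌋ then c
      else if ⌊ i <? j ⌋ then 0 else 1

    label-q : ∀ j → label q j ≡ b j
    label-q j with q ≟ q
    ... | yes _   = refl
    ... | no q≢q  = contradiction refl q≢q

    label-col-q : ∀ {i} → i ≢ q → label i q ≡ a i
    label-col-q {i} i≢q with i ≟ q | q ≟ q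
    ... | yes i≡q | _    = contradiction i≡q i≢q
    ... | no _ | yes _   = refl
    ... | no _ | no q≢q  = contradiction refl q≢q

    label-p : ∀ {j} → j ≢ q → label p j ≡ c
    label-p {j} j≢q with p ≟ q | j ≟ q | p ≟ p
    ... | yes p≡q | _ | _      = contradiction p≡q p≢q
    ... | no _ | yes j≡q | _   = contradiction j≡q j≢q
    ... | no _ | no _ | yes _  = refl
    ... | no _ | no _ | no p≢p = contradiction refl p≢p

    label-< : ∀ {i j} → i ≢ q → j ≢ q → i ≢ p → i < j → label i j ≡ 0
    label-< {i} {j} i≢q j≢q i≢p i<j with i ≟ q | j ≟ q | i ≟ p | i <? j
    ... | yes i≡q | _ | _ | _      = contradiction i≡q i≢q
    ... | no _ | yes j≡q | _ | _   = contradiction j≡q j≢q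
    ... | no _ | no _ | yes i≡p | _ = contradiction i≡p i≢p
    ... | no _ | no _ | no _ | yes _ = refl
    ... | no _ | no _ | no _ | no i≮j = contradiction i<j i≮j

    label-> : ∀ {i j} → i ≢ q → j ≢ q → i ≢ p → j < i → label i j ≡ 1
    label-> {i} {j} i≢q j≢q i≢p j<i with i ≟ q | j ≟ q | i ≟ p | i <? j
    ... | yes i≡q | _ | _ | _      = contradiction i≡q i≢q
    ... | no _ | yes j≡q | _ | _   = contradiction j≡q j≢q
    ... | no _ | no _ | yes i≡p | _ = contradiction i≡p i≢p
    ... | no _ | no _ | no _ | yes i<j = contradiction j<i (<⇒≯ i<j)
    ... | no _ | no _ | no _ | no _ = refl

  -- Apart from symmetry and 0 ~ 1 (the image of
  -- edges between vertices labelled by order), each field is the image of one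
  -- family of edges; the comment gives a representative edge.
  record Respects (R : ℕ → ℕ → Set) (a b : ℕ → ℕ) (c : ℕ) : Set where
    field
      R-sym     : ∀ {x y} → R x y → R y x
      zero-one  : R 0 1
      a-b       : ∀ i → i < q → R (a i) (b i)                -- (i , q) → (q , i)
      a-b-up    : ∀ i → suc i < q → R (a i) (b (suc i))      -- (i , q) → (q , i + 1)
      a-b-down  : ∀ i → suc i < q → R (a (suc i)) (b i)      -- (i + 1 , q) → (q , i)
      bp-ap     : R (b p) (a p)                              -- (q , p) → (p , q)
      zero-ap   : R 0 (a p)                                  -- (0 , p) → (p , q)
      bp-c      : R (b p) c                                  -- (q , p) → (p , 0)
      c-zero    : R c 0                                      -- (p , 0) → (0 , 1)
      b0-a0     : R (b 0) (a 0)                              -- (q , 0) → (0 , q)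
      b0-zero   : R (b 0) 0                                  -- (q , 0) → (0 , 1)
      c-a0      : R c (a 0)                                  -- (p , 0) → (0 , q)
      one-a0    : R 1 (a 0)                                  -- (1 , 0) → (0 , q)

  below-q : ∀ {x} → x < k → x ≢ q → x < q
  below-q x<k x≢q = ≤∧≢⇒< (s≤s⁻¹ x<k) x≢q

  below-p : ∀ {x} → x < k → x ≢ q → x ≢ p → x < p
  below-p x<k x≢q x≢p = ≤∧≢⇒< (s≤s⁻¹ (below-q x<k x≢q)) x≢p

  module Labelling {R : ℕ → ℕ → Set} {a b : ℕ → ℕ} {c : ℕ} (resp : Respects R a b c) where
    open Respects resp
    open Labels a b c

    relabel : ∀ {x y x′ y′} → x′ ≡ x → y′ ≡ y → R x y → R x′ y′
    relabel refl refl r = r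

    through-q : ∀ {i m} → i < k → i ≢ q → m ≢ q → EdgeShape i q m → R (label i q) (label q m)
    through-q {i} {m} i<k i≢q m≢q shape = relabel (label-col-q i≢q) (label-q m) (go shape)
      where
      go : EdgeShape i q m → R (a i) (b m)
      go (returning refl)    = a-b i (below-q i<k i≢q)
      go (through0 ())
      go (throughP q≡p)      = contradiction (sym q≡p) p≢q
      go (stepUp refl m<q)   = a-b-up i m<q
      go (stepDown refl i<q) = a-b-down m i<q

    through-p : ∀ {i m} → i < k → i ≢ p → R (label i p) (label p m)
    through-p {i} {m} i<k i≢p = by-cases (i ≟ q) (m ≟ q)
      where
      by-cases : Dec (i ≡ q) → Dec (m ≡ q) → R (label i p) (label p m)
      by-cases (yes refl) (yes refl) = relabel (label-q p) (label-col-q p≢q) bp-ap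
      by-cases (yes refl) (no m≢q)   = relabel (label-q p) (label-p m≢q) bp-c
      by-cases (no i≢q) (yes refl)   = relabel (label-< i≢q p≢q i≢p (below-p i<k i≢q i≢p)) (label-col-q p≢q) zero-ap
      by-cases (no i≢q) (no m≢q)     = relabel (label-< i≢q p≢q i≢p (below-p i<k i≢q i≢p)) (label-p m≢q) (R-sym c-zero)

    through-0 : ∀ {i m} → i ≢ 0 → m ≢ 0 → R (label i 0) (label 0 m)
    through-0 {i} {m} i≢0 m≢0 = by-cases (i ≟ q) (i ≟ p) (m ≟ q)
      where
      0≢q : 0 ≢ q
      0≢q ()
      0≢p : 0 ≢ p
      0≢p ()
      0<i : 0 < i
      0<i = n≢0⇒n>0 i≢0
      0<m : 0 < m
      0<m = n≢0⇒n>0 m≢0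
      by-cases : Dec (i ≡ q) → Dec (i ≡ p) → Dec (m ≡ q) → R (label i 0) (label 0 m)
      by-cases (yes refl) _ (yes refl)      = relabel (label-q 0) (label-col-q 0≢q) b0-a0
      by-cases (yes refl) _ (no m≢q)        = relabel (label-q 0) (label-< 0≢q m≢q 0≢p 0<m) b0-zero
      by-cases (no _) (yes refl) (yes refl) = relabel (label-p 0≢q) (label-col-q 0≢q) c-a0
      by-cases (no _) (yes refl) (no m≢q)   = relabel (label-p 0≢q) (label-< 0≢q m≢q 0≢p 0<m) c-zero
      by-cases (no i≢q) (no i≢p) (yes refl) = relabel (label-> i≢q 0≢q i≢p 0<i) (label-col-q 0≢q) one-a0
      by-cases (no i≢q) (no i≢p) (no m≢q)   =
        relabel (label-> i≢q 0≢q i≢p 0<i) (label-< 0≢q m≢q 0≢p 0<m) (R-sym zero-one)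

    -- Away from row p and column q the labels only record the order of the two
    -- columns, so an edge whose middle column lies on the same side of both
    -- ends is mapped to 0 ~ 1.
    same-side : ∀ {i j m} → i ≢ q → i ≢ p → j ≢ q → j ≢ p → m ≢ q →
                (i < j × m < j) ⊎ (j < i × j < m) → R (label i j) (label j m)
    same-side i≢q i≢p j≢q j≢p m≢q (inj₁ (i<j , m<j)) =
      relabel (label-< i≢q j≢q i≢p i<j) (label-> j≢q m≢q j≢p m<j) zero-one
    same-side i≢q i≢p j≢q j≢p m≢q (inj₂ (j<i , j<m)) =
      relabel (label-> i≢q j≢q i≢p j<i) (label-< j≢q m≢q j≢p j<m) (R-sym zero-one)

    interior-returning : ∀ {i j} → j < k → i ≢ j → j ≢ q → j ≢ p → R (label i j) (label j i)
    interior-returning {i} {j} j<k i≢j j≢q j≢p = by-cases (i ≟ q) (i ≟ p)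
      where
      sides : Tri (i < j) (i ≡ j) (j < i) → (i < j × i < j) ⊎ (j < i × j < i)
      sides (tri< i<j _ _) = inj₁ (i<j , i<j)
      sides (tri≈ _ i≡j _) = contradiction i≡j i≢j
      sides (tri> _ _ j<i) = inj₂ (j<i , j<i)
      by-cases : Dec (i ≡ q) → Dec (i ≡ p) → R (label i j) (label j i)
      by-cases (yes refl) _      = relabel (label-q j) (label-col-q j≢q) (R-sym (a-b j (below-q j<k j≢q)))
      by-cases (no _) (yes refl) = relabel (label-p j≢q) (label-< j≢q p≢q j≢p (below-p j<k j≢q j≢p)) c-zero
      by-cases (no i≢q) (no i≢p) = same-side i≢q i≢p j≢q j≢p i≢q (sides (<-cmp i j))

    interior-up : ∀ {i j} → i ≢ j → j ≢ suc i → j ≢ q → j ≢ p → suc i < q →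
                  R (label i j) (label j (suc i))
    interior-up {i} {j} i≢j j≢i+1 j≢q j≢p i+1<q =
      same-side i≢q i≢p j≢q j≢p (<⇒≢ i+1<q) (sides (<-cmp i j))
      where
      i≢q : i ≢ q
      i≢q = <⇒≢ (<-trans (n<1+n i) i+1<q)
      i≢p : i ≢ p
      i≢p refl = <-irrefl refl i+1<q
      sides : Tri (i < j) (i ≡ j) (j < i) → (i < j × suc i < j) ⊎ (j < i × j < suc i)
      sides (tri< i<j _ _) = inj₁ (i<j , ≤∧≢⇒< i<j (≢-sym j≢i+1))
      sides (tri≈ _ i≡j _) = contradiction i≡j i≢j
      sides (tri> _ _ j<i) = inj₂ (j<i , <-trans j<i (n<1+n i))

    interior-down : ∀ {j m} → j < k → suc m ≢ j → j ≢ m → j ≢ q → j ≢ p → suc m < q →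
                    R (label (suc m) j) (label j m)
    interior-down {j} {m} j<k m+1≢j j≢m j≢q j≢p m+1<q = by-cases (suc m ≟ p)
      where
      m≢q : m ≢ q
      m≢q = <⇒≢ (<-trans (n<1+n m) m+1<q)
      below-m : j < suc m → j < m
      below-m j<m+1 = ≤∧≢⇒< (s≤s⁻¹ j<m+1) j≢m
      sides : Tri (suc m < j) (suc m ≡ j) (j < suc m) → (suc m < j × m < j) ⊎ (j < suc m × j < m)
      sides (tri< m+1<j _ _) = inj₁ (m+1<j , <-trans (n<1+n m) m+1<j)
      sides (tri≈ _ m+1≡j _) = contradiction m+1≡j m+1≢j
      sides (tri> _ _ j<m+1) = inj₂ (j<m+1 , below-m j<m+1)
      by-cases : Dec (suc m ≡ p) → R (label (suc m) j) (label j m)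
      by-cases (yes m+1≡p) = relabel (subst (λ x → label x j ≡ c) (sym m+1≡p) (label-p j≢q))
        (label-< j≢q m≢q j≢p (below-m (subst (j <_) (sym m+1≡p) (below-p j<k j≢q j≢p)))) c-zero
      by-cases (no m+1≢p) = same-side (<⇒≢ m+1<q) m+1≢p j≢q j≢p m≢q (sides (<-cmp (suc m) j))

    through-interior : ∀ {i j m} → j < k → i ≢ j → j ≢ m → j ≢ q → j ≢ p → j ≢ 0 →
                       EdgeShape i j m → R (label i j) (label j m)
    through-interior j<k i≢j j≢m j≢q j≢p j≢0 (returning refl)     = interior-returning j<k i≢j j≢q j≢p
    through-interior j<k i≢j j≢m j≢q j≢p j≢0 (through0 j≡0)      = contradiction j≡0 j≢0
    through-interior j<k i≢j j≢m j≢q j≢p j≢0 (throughP j≡p)      = contradiction j≡p j≢p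
    through-interior j<k i≢j j≢m j≢q j≢p j≢0 (stepUp refl i+1<q)   = interior-up i≢j j≢m j≢q j≢p i+1<q
    through-interior j<k i≢j j≢m j≢q j≢p j≢0 (stepDown refl m+1<q) = interior-down j<k i≢j j≢m j≢q j≢p m+1<q

    label-edge : ∀ {i j m} → i < k → j < k → i ≢ j → j ≢ m → EdgeShape i j m →
                 R (label i j) (label j m)
    label-edge {i} {j} {m} i<k j<k i≢j j≢m shape = by-middle (j ≟ q) (j ≟ p) (j ≟ 0)
      where
      by-middle : Dec (j ≡ q) → Dec (j ≡ p) → Dec (j ≡ 0) → R (label i j) (label j m)
      by-middle (yes refl) _ _               = through-q i<k i≢j (≢-sym j≢m) shape
      by-middle (no _) (yes refl) _          = through-p i<k i≢j
      by-middle (no _) (no _) (yes refl)     = through-0 i≢j (≢-sym j≢m)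
      by-middle (no j≢q) (no j≢p) (no j≢0)   = through-interior j<k i≢j j≢m j≢q j≢p j≢0 shape

    vertex-label : Vertex k → ℕ
    vertex-label u = label (toℕ (fstC u)) (toℕ (sndC u))

    vertex-label-directed : ∀ u v → AdjDir (T-II k) u v → R (vertex-label u) (vertex-label v)
    vertex-label-directed u v u→v@(j≡j , _) =
      subst (λ x → R (vertex-label u) (label x (toℕ (sndC v)))) (cong toℕ j≡j)
        (label-edge (toℕ<n (fstC u)) (toℕ<n (sndC u)) (distinct u)
                    (subst (_≢ toℕ (sndC v)) (sym (cong toℕ j≡j)) (distinct v))
                    (edge-shape (adjDir⇒incompatible {m = k} {E = entry k} {u} {v} u→v)))
      where
      distinct : ∀ w → toℕ (fstC w) ≢ toℕ (sndC w)
      distinct w e = proj₂ w (toℕ-injective e)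

    vertex-label-hom : ∀ u v → Adj (T-II k) u v → R (vertex-label u) (vertex-label v)
    vertex-label-hom u v (inj₁ u→v) = vertex-label-directed u v u→v
    vertex-label-hom u v (inj₂ v→u) = R-sym (vertex-label-directed v u v→u)

module LowerBound (n : ℕ) where
  open Shape n

  module OddLabels where
    a b : ℕ → ℕ
    a i = if odd i then suc i else i
    b i = if odd i then i else suc i

    respects : odd p ≡ true → Respects (Step ⊥ k 0) a b q
    respects p-odd = record
      { R-sym = step-sym
      ; zero-one = forward refl
      ; a-b = λ i _ → a-b i
      ; a-b-up = λ i _ → a-b-up i
      ; a-b-down = λ i _ → a-b-down i
      ; bp-ap = bp-ap
      ; zero-ap = zero-ap
      ; bp-c = bp-c
      ; c-zero = wrapForward refl
      ; b0-a0 = backward refl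
      ; b0-zero = backward refl
      ; c-a0 = wrapForward refl
      ; one-a0 = backward refl }
      where
      a-b : ∀ i → Step ⊥ k 0 (a i) (b i)
      a-b i with odd i
      ... | true  = backward refl
      ... | false = forward refl
      a-b-up : ∀ i → Step ⊥ k 0 (a i) (b (suc i))
      a-b-up i with odd i
      ... | true  = forward refl
      ... | false = forward refl
      a-b-down : ∀ i → Step ⊥ k 0 (a (suc i)) (b i)
      a-b-down i with odd i
      ... | true  = backward refl
      ... | false = backward refl
      bp-ap : Step ⊥ k 0 (b p) (a p)
      bp-ap rewrite p-odd = forward refl
      zero-ap : Step ⊥ k 0 0 (a p)
      zero-ap rewrite p-odd = wrapBackward refl
      bp-c : Step ⊥ k 0 (b p) q
      bp-c rewrite p-odd = forward refl

  module EvenLabels where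
    a b : ℕ → ℕ
    a i = if odd i then suc i else suc i + k
    b i = if odd i then suc i + k else suc i

    respects : odd p ≡ false → Respects (Step ⊤ (k + k) k) a b k
    respects p-even = record
      { R-sym = step-sym
      ; zero-one = forward refl
      ; a-b = λ i _ → a-b i
      ; a-b-up = λ i _ → a-b-up i
      ; a-b-down = λ i _ → a-b-down i
      ; bp-ap = bp-ap
      ; zero-ap = zero-ap
      ; bp-c = bp-c
      ; c-zero = chordBackward tt refl
      ; b0-a0 = chordForward tt refl
      ; b0-zero = backward refl
      ; c-a0 = forward refl
      ; one-a0 = chordForward tt refl }
      where
      a-b : ∀ i → Step ⊤ (k + k) k (a i) (b i)
      a-b i with odd i
      ... | true  = chordForward tt refl
      ... | false = chordBackward tt refl
      a-b-up : ∀ i → Step ⊤ (k + k) k (a i) (b (suc i))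
      a-b-up i with odd i
      ... | true  = forward refl
      ... | false = forward refl
      a-b-down : ∀ i → Step ⊤ (k + k) k (a (suc i)) (b i)
      a-b-down i with odd i
      ... | true  = backward refl
      ... | false = backward refl
      bp-ap : Step ⊤ (k + k) k (b p) (a p)
      bp-ap rewrite p-even = chordForward tt refl
      zero-ap : Step ⊤ (k + k) k 0 (a p)
      zero-ap rewrite p-even = wrapBackward refl
      bp-c : Step ⊤ (k + k) k (b p) k
      bp-c rewrite p-even = forward refl

  odd-cycle-≥k : ¬ (2 ∣ k) → ∀ L → ¬ (2 ∣ L) → Cycle (T-II k) L → k ≤ L
  odd-cycle-≥k 2∤k L 2∤L C =
    oddClosedWalk-cycleGraph (cycle⇒closedWalk vertex-label vertex-label-hom C) 2∤L
    where open Labelling (OddLabels.respects (odd-p 2∤k))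

  odd-cycle-≥k+1 : 2 ∣ k → ∀ L → ¬ (2 ∣ L) → Cycle (T-II k) L → suc k ≤ L
  odd-cycle-≥k+1 2∣k L 2∤L C =
    oddClosedWalk-möbius (cycle⇒closedWalk vertex-label vertex-label-hom C) 2∤L 2∣k
    where open Labelling (EvenLabels.respects (even-p 2∣k))

module UpperBound (n : ℕ) where
  open Shape n

  walk : ℕ → ℕ × ℕ
  walk zero = (0 , p)
  walk (suc s) with s <? q
  ... | yes _ = if odd s then (s , q) else (q , s)
  ... | no _  = (p , 0)

  walk-odd : ∀ {s} → s < q → odd s ≡ true → walk (suc s) ≡ (s , q)
  walk-odd {s} s<q odd-s with s <? q
  ... | yes _   rewrite odd-s = refl
  ... | no s≮q  = contradiction s<q s≮q

  walk-even : ∀ {s} → s < q → odd s ≡ false → walk (suc s) ≡ (q , s)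
  walk-even {s} s<q even-s with s <? q
  ... | yes _   rewrite even-s = refl
  ... | no s≮q  = contradiction s<q s≮q

  walk-end : walk (suc q) ≡ (p , 0)
  walk-end with q <? q
  ... | yes q<q = contradiction q<q (<-irrefl refl)
  ... | no _    = refl

  position : ℕ × ℕ → ℕ
  position (i , j) =
    if ⌊ i ≟ q ⌋ then suc j
    else if ⌊ j ≟ q ⌋ then suc i
    else if ⌊ j ≟ p ⌋ then 0
    else suc q

  walk-cases : ∀ {t} → t ≤ suc q → (P : ℕ → ℕ × ℕ → Set) →
               P 0 (0 , p) →
               (∀ {s} → s < q → odd s ≡ true → P (suc s) (s , q)) →
               (∀ {s} → s < q → odd s ≡ false → P (suc s) (q , s)) →
               P (suc q) (p , 0) →
               P t (walk t)
  walk-cases {zero} _ P start _ _ _ = start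
  walk-cases {suc s} s+1≤q+1 P _ oddCase evenCase end with m≤n⇒m<n∨m≡n (s≤s⁻¹ s+1≤q+1)
  ... | inj₂ refl = subst (P (suc q)) (sym walk-end) end
  ... | inj₁ s<q with odd s in parity-s
  ...   | true  = subst (P (suc s)) (sym (walk-odd s<q parity-s)) (oddCase s<q parity-s)
  ...   | false = subst (P (suc s)) (sym (walk-even s<q parity-s)) (evenCase s<q parity-s)

  walk-valid : ∀ {t} → t ≤ suc q → ValidPair k (walk t)
  walk-valid t≤ = walk-cases t≤ (λ _ → ValidPair k)
    (pair 0<k p<k (λ ()))
    (λ s<q _ → pair (<-trans s<q q<k) q<k (<⇒≢ s<q))
    (λ s<q _ → pair q<k (<-trans s<q q<k) (≢-sym (<⇒≢ s<q)))
    (pair p<k 0<k (λ ()))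
    where
    pair : ∀ {i j} → i < k → j < k → i ≢ j → ValidPair k (i , j)
    pair i<k j<k i≢j = record { fst< = i<k ; snd< = j<k ; fst≢snd = i≢j }
    0<k : 0 < k
    0<k = s≤s z≤n

  walk-position : ∀ {t} → t ≤ suc q → position (walk t) ≡ t
  walk-position t≤ = walk-cases t≤ (λ t ij → position ij ≡ t) start oddCase evenCase end
    where
    start : position (0 , p) ≡ 0
    start with p ≟ q | p ≟ p
    ... | yes p≡q | _   = contradiction p≡q p≢q
    ... | no _ | yes _  = refl
    ... | no _ | no p≢p = contradiction refl p≢p
    oddCase : ∀ {s} → s < q → odd s ≡ true → position (s , q) ≡ suc s
    oddCase {s} s<q _ with s ≟ q | q ≟ q
    ... | yes s≡q | _   = contradiction s≡q (<⇒≢ s<q)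
    ... | no _ | yes _  = refl
    ... | no _ | no q≢q = contradiction refl q≢q
    evenCase : ∀ {s} → s < q → odd s ≡ false → position (q , s) ≡ suc s
    evenCase {s} _ _ with q ≟ q
    ... | yes _   = refl
    ... | no q≢q  = contradiction refl q≢q
    end : position (p , 0) ≡ suc q
    end with p ≟ q
    ... | yes p≡q = contradiction p≡q p≢q
    ... | no _    = refl

  Edge : ℕ × ℕ → ℕ × ℕ → Set
  Edge = Adjacentℕ k (entry k)

  separated : ∀ r → r < k → ∀ {i j m} → entry k r i ≡ true → entry k r m ≡ true →
              entry k r j ≡ false → Incompatible k (entry k) i j m
  separated r r<k ri rm rj = inj₂ (r , r<k , ri , rm , rj)

  band-separates : ∀ {s} → suc s < q → ∀ {i m} → i ≡ s ⊎ i ≡ suc s → m ≡ s ⊎ m ≡ suc s →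
                   Incompatible k (entry k) i q m
  band-separates {s} s+1<q i∈ m∈ =
    separated s (<-trans (<-trans (n<1+n s) s+1<q) q<k) (band-in band i∈) (band-in band m∈)
      (band-out band (λ q≡s → <⇒≢ (<-trans (n<1+n s) s+1<q) (sym q≡s)) (λ q≡s+1 → <⇒≢ s+1<q (sym q≡s+1)))
    where
    band : s + 2 < k
    band = ≤-trans (≤-reflexive (cong suc (+-comm s 2))) (s≤s s+1<q)

  edge-start : Edge (0 , p) (q , 0)
  edge-start = inj₂ (refl , separated q q<k {j = 0} (q-row-one q≢0) (q-row-one p≢0) q-row-0)

  edge-up : ∀ {s} → suc s < q → Edge (s , q) (q , suc s)
  edge-up s+1<q = inj₁ (refl , band-separates s+1<q (inj₁ refl) (inj₂ refl))

  edge-down : ∀ {s} → suc s < q → Edge (q , s) (suc s , q)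
  edge-down s+1<q = inj₂ (refl , band-separates s+1<q (inj₂ refl) (inj₁ refl))

  edge-to-end : Edge (q , p) (p , 0)
  edge-to-end = inj₁ (refl , separated p p<k {j = p} (p-row-one (≢-sym p≢q)) (p-row-one (≢-sym p≢0)) p-row-diag)

  edge-close-odd : Edge (p , q) (0 , p)
  edge-close-odd = inj₂ (refl , separated p p<k {j = p} (p-row-one (≢-sym p≢0)) (p-row-one (≢-sym p≢q)) p-row-diag)

  edge-close-even : Edge (p , 0) (0 , p)
  edge-close-even = inj₁ (refl , inj₁ refl)

  walk-next : ∀ {t} → t < q → Edge (walk t) (walk (suc t))
  walk-next {zero} _ = subst (Edge (0 , p)) (sym (walk-even (s≤s z≤n) refl)) edge-start
  walk-next {suc s} s+1<q with odd s in parity-s | <-trans (n<1+n s) s+1<q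
  ... | true  | s<q = subst₂ Edge (sym (walk-odd s<q parity-s))
                                  (sym (walk-even s+1<q (cong not parity-s))) (edge-up s+1<q)
  ... | false | s<q = subst₂ Edge (sym (walk-even s<q parity-s))
                                  (sym (walk-odd s+1<q (cong not parity-s))) (edge-down s+1<q)

  cycle-k : ¬ (2 ∣ k) → Cycle (T-II k) k
  cycle-k 2∤k = cycle-from-pairs {rows = k} {E = entry k} walk position (s≤s (s≤s (s≤s z≤n)))
    (λ t t<k → walk-valid (<⇒≤ t<k)) (λ t t<k → walk-position (<⇒≤ t<k))
    (λ t t+1<k → walk-next (s≤s⁻¹ t+1<k))
    close
    where
    close : ∀ t → suc t ≡ k → Edge (walk t) (walk 0)
    close t refl = subst (λ ij → Edge ij (0 , p)) (sym (walk-odd (n<1+n p) (odd-p 2∤k))) edge-close-odd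

  cycle-k+1 : 2 ∣ k → Cycle (T-II k) (suc k)
  cycle-k+1 2∣k = cycle-from-pairs {rows = k} {E = entry k} walk position (s≤s (s≤s (s≤s z≤n)))
    (λ t t<k+1 → walk-valid (s≤s⁻¹ t<k+1)) (λ t t<k+1 → walk-position (s≤s⁻¹ t<k+1))
    next close
    where
    next : ∀ t → suc t < suc k → Edge (walk t) (walk (suc t))
    next t t+1<k+1 with m≤n⇒m<n∨m≡n (s≤s⁻¹ (s≤s⁻¹ t+1<k+1))
    ... | inj₁ t<q  = walk-next t<q
    ... | inj₂ refl = subst₂ Edge (sym (walk-even (n<1+n p) (even-p 2∣k))) (sym walk-end) edge-to-end
    close : ∀ t → suc t ≡ suc k → Edge (walk t) (walk 0)
    close t refl = subst (λ ij → Edge ij (0 , p)) (sym walk-end) edge-close-even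

∣⇒∤suc : ∀ {x} → 2 ∣ x → ¬ (2 ∣ suc x)
∣⇒∤suc {x} 2∣x 2∣x+1 = contradiction (∣1⇒≡1 (∣m+n∣m⇒∣n (subst (2 ∣_) (+-comm 1 x) 2∣x+1) 2∣x)) (λ ())

lemma3p3 : (k : ℕ) → 4 ≤ k →
    ((¬ (2 ∣ k)) → SmallestOddCycleLength (T-II k) k) ×
    ((2 ∣ k) → SmallestOddCycleLength (T-II k) (suc k))
lemma3p3 _ (s≤s (s≤s (s≤s (s≤s (z≤n {n}))))) = k-odd , k-even
  where
  open Shape n
  open LowerBound n
  open UpperBound n

  k-odd : ¬ (2 ∣ k) → SmallestOddCycleLength (T-II k) k
  k-odd 2∤k = (2∤k , cycle-k 2∤k) , odd-cycle-≥k 2∤k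

  k-even : 2 ∣ k → SmallestOddCycleLength (T-II k) (suc k)
  k-even 2∣k = (∣⇒∤suc 2∣k , cycle-k+1 2∣k) , odd-cycle-≥k+1 2∣k
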